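{- Let $a,b,c\geq1$ and $d=a+b+c$, $D=\{0,\dots,d-1\}$. Alice's announcement of $\sum_d A$ (equivalently, Bob's announcement of $\sum_d B$) is secure for all deals of size $(a,b,c)$ if and only if for every $0\leq x<d$ and every set $S\subset D$ with $|S|=a+b-1$ there are $A,B\subseteq S$ with $|A|=a$, $|B|=b$ and $\sum_d A=\sum_d B=x$.
   Context: Cards are the integers $0,\dots,d-1$. A deal of size $(a,b,c)$ is a triple $(A,B,C)$ of pairwise disjoint subsets of $D$ of sizes $a,b,c$ held by Alice, Bob and Cath respectively; initially each player knows only her own hand. For $X\subseteq D$, $\sum_d X$ is the sum of the elements of $X$ in $\mathbb Z/(d)$. Announcing $\sum_d A$ is secure for all deals of size $(a,b,c)$ if for every deal $(A,B,C)$ of that size and every card $z\notin C$ there exist deals $(A',B',C)$ and $(A'',B'',C)$ of that size with $\sum_d A'=\sum_d A''=\sum_d A$, $z\notin A'$ and $z\notin B''$; i.e. after the announcement Cath does not know of any card that Alice holds it nor of any card that Bob holds it. -}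

module Defs where

open import Data.Nat using (ℕ; zero; suc; _%_)
open import Data.Fin using (Fin; toℕ)
open import Data.Fin.Subset using (Subset; _∈_; _∉_; ∣_∣)
open import Data.Vec using (sum; zipWith; allFin)
open import Data.Bool using (if_then_else_)
open import Data.Product using (Σ; _×_; ∃; ∃-syntax)
open import Relation.Binary.PropositionalEquality using (_≡_)

-- reduction modulo d (d = 0 never occurs in the theorem since d ≥ 3)
modN : ℕ → ℕ → ℕ
modN zero    x = x
modN (suc n) x = x % suc n

sumD : {d : ℕ} → Subset d → ℕ
sumD {d} X = modN d (sum (zipWith (λ s i → if s then toℕ i else 0) X (allFin d)))

Disj : {d : ℕ} → Subset d → Subset d → Set
Disj X Y = ∀ x → x ∈ X → x ∉ Y

IsDeal : (a b c : ℕ) {d : ℕ} → Subset d → Subset d → Subset d → Set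
IsDeal a b c A B C =
  (Disj A B × Disj A C × Disj B C) × (∣ A ∣ ≡ a × ∣ B ∣ ≡ b × ∣ C ∣ ≡ c)

SecureSum : (a b c d : ℕ) → Set
SecureSum a b c d =
  ∀ (A B C : Subset d) → IsDeal a b c A B C →
  ∀ (z : Fin d) → z ∉ C →
    (∃[ A' ] ∃[ B' ] (IsDeal a b c A' B' C × sumD A' ≡ sumD A × z ∉ A'))
  × (∃[ A'' ] ∃[ B'' ] (IsDeal a b c A'' B'' C × sumD A'' ≡ sumD A × z ∉ B''))

-- A deal is determined by Cath's hand C and Alice's hand A, Bob holding the rest of ∁ C, so Bob's
-- sum is the sum of ∁ C minus Alice's sum.
--
-- (⇐) For z ∉ C apply the condition to S = ∁ C - z and to Alice's (resp. Bob's) sum: the hand found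
-- avoids z, and the other player receives the rest of ∁ C.
--
-- (⇒) The residues Alice's sum can take for a fixed C are closed under +1: choose z ∉ C with
-- z + 1 ∈ C (mod d); security lets Bob lack z, so Alice holds it, and trading it for Cath's z + 1
-- raises her sum by one; security applied to the card z + 1 then gives Cath her hand C back. Hence
-- every residue x occurs. Given S with ∣ S ∣ = a + b - 1, pick w ∉ S and let C = ∁ S - w: a deal in
-- which Alice's sum is x, made to avoid w by security, has Alice's hand inside S. Bob is symmetric.
module Submission where

open import Defs
open import Algebra.Properties.CommutativeSemigroup as CS using ()
open import Data.Bool.Base using (if_then_else_)
open import Data.Fin.Base using (Fin; zero; suc; toℕ)
open import Data.Fin.Properties using (toℕ<n; toℕ-fromℕ<; toℕ-injective; _≟_)
open import Data.Fin.Subset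
  using (Subset; inside; outside; _∈_; _∉_; _⊆_; ∣_∣; ∁; _∪_; _─_; _-_; ⁅_⁆; ⊥; Nonempty)
open import Data.Fin.Subset.Properties
open import Data.Nat.Base
  using (ℕ; zero; suc; _+_; _*_; _∸_; _≤_; _<_; z≤n; s≤s; NonZero; _%_; _/_)
open import Data.Nat.DivMod
  using (_mod_; %-distribˡ-+; m≡m%n+[m/n]*n; m%n<n; m%n≤n; m%n%n≡m%n; m<n⇒m%n≡m;
         [m+n]%n≡m%n; [m+kn]%n≡m%n)
open import Data.Nat.Properties
  using (+-assoc; +-comm; +-suc; +-identityʳ; +-cancelʳ-≡; suc-injective; +-commutativeSemigroup;
         m+n∸n≡m; m+n∸m≡n; m+[n∸m]≡n; m∸n+n≡m; m≤m+n; <⇒≤; ≤-pred; ≤-trans; ≤-reflexive;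
         <-irrefl)
open import Data.Product using (∃-syntax; _×_; _,_; proj₁; proj₂)
open import Data.Sum using (_⊎_; inj₁; inj₂)
open import Data.Vec.Base using ([]; _∷_; here; there; sum; zipWith; tabulate)
open import Function.Base using (_∘_)
open import Function.Bundles using (_⇔_; mk⇔)
open import Relation.Nullary using (¬_; yes; no; contradiction)
open import Relation.Unary using (Decidable)
open import Relation.Binary.PropositionalEquality

open CS +-commutativeSemigroup using (x∙yz≈y∙xz)

private variable
  n : ℕ
  p q : Subset n
  i j x : Fin n

weight : (Fin n → ℕ) → Subset n → ℕ
weight f []            = 0
weight f (inside ∷ p)  = f zero + weight (f ∘ suc) p
weight f (outside ∷ p) = weight (f ∘ suc) p

sumOf : Subset n → ℕ
sumOf = weight toℕ

∣p∣≡weight : (p : Subset n) → ∣ p ∣ ≡ weight (λ _ → 1) p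
∣p∣≡weight []            = refl
∣p∣≡weight (inside ∷ p)  = cong suc (∣p∣≡weight p)
∣p∣≡weight (outside ∷ p) = ∣p∣≡weight p

weight-⊥ : (f : Fin n → ℕ) → weight f ⊥ ≡ 0
weight-⊥ {zero}  f = refl
weight-⊥ {suc n} f = weight-⊥ (f ∘ suc)

weight-⁅⁆ : (f : Fin n → ℕ) (i : Fin n) → weight f ⁅ i ⁆ ≡ f i
weight-⁅⁆ f zero    = trans (cong (f zero +_) (weight-⊥ (f ∘ suc))) (+-identityʳ (f zero))
weight-⁅⁆ f (suc i) = weight-⁅⁆ (f ∘ suc) i

weight-─ : (f : Fin n → ℕ) → q ⊆ p → weight f (p ─ q) + weight f q ≡ weight f p
weight-─ {q = []}          {[]}          f q⊆p = refl
weight-─ {q = inside ∷ q}  {inside ∷ p}  f q⊆p =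
  trans (x∙yz≈y∙xz (weight (f ∘ suc) (p ─ q)) (f zero) _)
        (cong (f zero +_) (weight-─ (f ∘ suc) (drop-∷-⊆ q⊆p)))
weight-─ {q = inside ∷ q}  {outside ∷ p} f q⊆p with () ← q⊆p here
weight-─ {q = outside ∷ q} {inside ∷ p}  f q⊆p =
  trans (+-assoc (f zero) _ _) (cong (f zero +_) (weight-─ (f ∘ suc) (drop-∷-⊆ q⊆p)))
weight-─ {q = outside ∷ q} {outside ∷ p} f q⊆p = weight-─ (f ∘ suc) (drop-∷-⊆ q⊆p)

Disj-∷⁻ : ∀ {s t} → Disj (s ∷ p) (t ∷ q) → Disj p q
Disj-∷⁻ p#q i i∈p i∈q = p#q (suc i) (there i∈p) (there i∈q)

weight-∪ : (f : Fin n → ℕ) → Disj p q → weight f (p ∪ q) ≡ weight f p + weight f q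
weight-∪ {p = []}          {[]}          f p#q = refl
weight-∪ {p = inside ∷ p}  {inside ∷ q}  f p#q = contradiction here (p#q zero here)
weight-∪ {p = inside ∷ p}  {outside ∷ q} f p#q =
  trans (cong (f zero +_) (weight-∪ (f ∘ suc) (Disj-∷⁻ p#q))) (sym (+-assoc (f zero) _ _))
weight-∪ {p = outside ∷ p} {inside ∷ q}  f p#q =
  trans (cong (f zero +_) (weight-∪ (f ∘ suc) (Disj-∷⁻ p#q))) (x∙yz≈y∙xz (f zero) (weight (f ∘ suc) p) _)
weight-∪ {p = outside ∷ p} {outside ∷ q} f p#q = weight-∪ (f ∘ suc) (Disj-∷⁻ p#q)

∣p─q∣+∣q∣≡∣p∣ : q ⊆ p → ∣ p ─ q ∣ + ∣ q ∣ ≡ ∣ p ∣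
∣p─q∣+∣q∣≡∣p∣ {q = q} {p} q⊆p = begin
  ∣ p ─ q ∣ + ∣ q ∣                           ≡⟨ cong₂ _+_ (∣p∣≡weight (p ─ q)) (∣p∣≡weight q) ⟩
  weight (λ _ → 1) (p ─ q) + weight (λ _ → 1) q ≡⟨ weight-─ (λ _ → 1) q⊆p ⟩
  weight (λ _ → 1) p                           ≡⟨ ∣p∣≡weight p ⟨
  ∣ p ∣                                         ∎
  where open ≡-Reasoning

x∈p─q⇒x∉q : x ∈ p ─ q → x ∉ q
x∈p─q⇒x∉q {p = _ ∷ _} {_ ∷ _} (there x∈p─q) (there x∈q) = x∈p─q⇒x∉q x∈p─q x∈q

x∈p⇒⁅x⁆⊆p : x ∈ p → ⁅ x ⁆ ⊆ p
x∈p⇒⁅x⁆⊆p {x = x} x∈p y∈⁅x⁆ = subst (_∈ _) (sym (x∈⁅y⁆⇒x≡y x y∈⁅x⁆)) x∈p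

∣p-x∣+1≡∣p∣ : x ∈ p → ∣ p - x ∣ + 1 ≡ ∣ p ∣
∣p-x∣+1≡∣p∣ {x = x} {p} x∈p =
  trans (cong (∣ p - x ∣ +_) (sym (∣⁅x⁆∣≡1 x))) (∣p─q∣+∣q∣≡∣p∣ (x∈p⇒⁅x⁆⊆p x∈p))

x∉p-x : x ∉ p - x
x∉p-x {x = x} x∈p-x = x∈p─q⇒x∉q x∈p-x (x∈⁅x⁆ x)

Disj-∁-x⇒⊆ : Disj p (∁ q - x) → x ∉ p → p ⊆ q
Disj-∁-x⇒⊆ {q = q} {x} p#∁q-x x∉p {y} y∈p with y ∈? q
... | yes y∈q = y∈q
... | no  y∉q = contradiction (x∈p∧x≢y⇒x∈p-y (x∉p⇒x∈∁p y∉q) (λ { refl → x∉p y∈p })) (p#∁q-x y y∈p)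

Disj⇒⊆∁ : Disj p q → p ⊆ ∁ q
Disj⇒⊆∁ p#q {x} x∈p = x∉p⇒x∈∁p (p#q x x∈p)

⊆∁⇒Disj : p ⊆ ∁ q → Disj p q
⊆∁⇒Disj p⊆∁q x x∈p = x∈∁p⇒x∉p (p⊆∁q x∈p)

⊆∧∣q∣≤∣p∣⇒≡ : p ⊆ q → ∣ q ∣ ≤ ∣ p ∣ → p ≡ q
⊆∧∣q∣≤∣p∣⇒≡ {p = []}          {[]}          _   _ = refl
⊆∧∣q∣≤∣p∣⇒≡ {p = inside ∷ p}  {inside ∷ q}  p⊆q ∣q∣≤∣p∣ =
  cong (inside ∷_) (⊆∧∣q∣≤∣p∣⇒≡ (drop-∷-⊆ p⊆q) (≤-pred ∣q∣≤∣p∣))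
⊆∧∣q∣≤∣p∣⇒≡ {p = inside ∷ p}  {outside ∷ q} p⊆q _ with () ← p⊆q here
⊆∧∣q∣≤∣p∣⇒≡ {p = outside ∷ p} {inside ∷ q}  p⊆q ∣q∣≤∣p∣ =
  contradiction (≤-trans ∣q∣≤∣p∣ (p⊆q⇒∣p∣≤∣q∣ (drop-∷-⊆ p⊆q))) (<-irrefl refl)
⊆∧∣q∣≤∣p∣⇒≡ {p = outside ∷ p} {outside ∷ q} p⊆q ∣q∣≤∣p∣ =
  cong (outside ∷_) (⊆∧∣q∣≤∣p∣⇒≡ (drop-∷-⊆ p⊆q) ∣q∣≤∣p∣)

∃⊆-of-size : ∀ {n k} {p : Subset n} → k ≤ ∣ p ∣ → ∃[ q ] (q ⊆ p × ∣ q ∣ ≡ k)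
∃⊆-of-size {n} {zero} _ = ⊥ , ⊥⊆ , ∣⊥∣≡0 n
∃⊆-of-size {k = suc k} {p = inside ∷ p}  (s≤s k≤∣p∣) with ∃⊆-of-size k≤∣p∣
... | q , q⊆p , ∣q∣≡k = inside ∷ q , in⊆in q⊆p , cong suc ∣q∣≡k
∃⊆-of-size {k = suc k} {p = outside ∷ p} k<∣p∣ with ∃⊆-of-size k<∣p∣
... | q , q⊆p , ∣q∣≡k = outside ∷ q , out⊆ q⊆p , ∣q∣≡k

0<∣p∣⇒Nonempty : ∀ {n} {p : Subset n} → 0 < ∣ p ∣ → Nonempty p
0<∣p∣⇒Nonempty {n} {p} 0<∣p∣ with nonempty? p
... | yes ne = ne
... | no ¬ne =
  contradiction (trans (cong ∣_∣ (Empty-unique ¬ne)) (∣⊥∣≡0 n)) (λ ∣p∣≡0 → <-irrefl (sym ∣p∣≡0) 0<∣p∣)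

replace : Fin n → Fin n → Subset n → Subset n
replace i j p = (p - i) ∪ ⁅ j ⁆

∈-replace⁻ : x ∈ replace i j p → x ≡ j ⊎ (x ∈ p × x ≢ i)
∈-replace⁻ {i = i} {j} {p} x∈ with x∈p∪q⁻ (p - i) ⁅ j ⁆ x∈
... | inj₁ x∈p-i = inj₂ (p─q⊆p p ⁅ i ⁆ x∈p-i , x∉⁅y⁆⇒x≢y (x∈p─q⇒x∉q x∈p-i))
... | inj₂ x∈⁅j⁆ = inj₁ (x∈⁅y⁆⇒x≡y j x∈⁅j⁆)

i∉replace : i ∈ p → j ∉ p → i ∉ replace i j p
i∉replace i∈p j∉p i∈replace with ∈-replace⁻ i∈replace
... | inj₁ refl       = j∉p i∈p
... | inj₂ (_ , i≢i) = i≢i refl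

p⊆replace∪⁅i⁆ : p ⊆ replace i j p ∪ ⁅ i ⁆
p⊆replace∪⁅i⁆ {i = i} {x = x} x∈p with x ≟ i
... | yes refl = x∈p∪q⁺ (inj₂ (x∈⁅x⁆ x))
... | no x≢i   = x∈p∪q⁺ (inj₁ (x∈p∪q⁺ (inj₁ (x∈p∧x≢y⇒x∈p-y x∈p x≢i))))

weight-replace : (f : Fin n → ℕ) → i ∈ p → j ∉ p →
                 weight f (replace i j p) + f i ≡ weight f p + f j
weight-replace {i = i} {p} {j} f i∈p j∉p = begin
  weight f ((p - i) ∪ ⁅ j ⁆) + f i     ≡⟨ cong (_+ f i) (weight-∪ f p-i#⁅j⁆) ⟩
  weight f (p - i) + weight f ⁅ j ⁆ + f i ≡⟨ cong (λ m → weight f (p - i) + m + f i) (weight-⁅⁆ f j) ⟩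
  weight f (p - i) + f j + f i          ≡⟨ CS.xy∙z≈xz∙y +-commutativeSemigroup _ (f j) (f i) ⟩
  weight f (p - i) + f i + f j          ≡⟨ cong (λ m → weight f (p - i) + m + f j) (weight-⁅⁆ f i) ⟨
  weight f (p - i) + weight f ⁅ i ⁆ + f j ≡⟨ cong (_+ f j) (weight-─ f (x∈p⇒⁅x⁆⊆p i∈p)) ⟩
  weight f p + f j                      ∎
  where
  open ≡-Reasoning
  p-i#⁅j⁆ : Disj (p - i) ⁅ j ⁆
  p-i#⁅j⁆ x x∈p-i x∈⁅j⁆ = j∉p (subst (_∈ p) (x∈⁅y⁆⇒x≡y j x∈⁅j⁆) (p─q⊆p p ⁅ i ⁆ x∈p-i))

∣replace∣≡∣p∣ : i ∈ p → j ∉ p → ∣ replace i j p ∣ ≡ ∣ p ∣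
∣replace∣≡∣p∣ {i = i} {p} {j} i∈p j∉p = +-cancelʳ-≡ 1 _ _ (begin
  ∣ replace i j p ∣ + 1                ≡⟨ cong (_+ 1) (∣p∣≡weight (replace i j p)) ⟩
  weight (λ _ → 1) (replace i j p) + 1 ≡⟨ weight-replace (λ _ → 1) i∈p j∉p ⟩
  weight (λ _ → 1) p + 1               ≡⟨ cong (_+ 1) (∣p∣≡weight p) ⟨
  ∣ p ∣ + 1                            ∎)
  where open ≡-Reasoning

IsDeal-swap : ∀ {n a b c} {A B C : Subset n} → IsDeal a b c A B C → IsDeal b a c B A C
IsDeal-swap ((A#B , A#C , B#C) , (∣A∣≡a , ∣B∣≡b , ∣C∣≡c)) =
  ((λ x x∈B x∈A → A#B x x∈A x∈B) , B#C , A#C) , (∣B∣≡b , ∣A∣≡a , ∣C∣≡c)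

b+a+c≡n : ∀ a b {c n} → a + b + c ≡ n → b + a + c ≡ n
b+a+c≡n a b {c} a+b+c≡n = trans (cong (_+ c) (+-comm b a)) a+b+c≡n

module _ {n a b c : ℕ} (a+b+c≡n : a + b + c ≡ n) where
  private variable A B C : Subset n

  ∣∁C∣≡a+b : ∣ C ∣ ≡ c → ∣ ∁ C ∣ ≡ a + b
  ∣∁C∣≡a+b {C} ∣C∣≡c = begin
    ∣ ∁ C ∣           ≡⟨ ∣∁p∣≡n∸∣p∣ C ⟩
    _ ∸ ∣ C ∣         ≡⟨ cong₂ _∸_ (sym a+b+c≡n) ∣C∣≡c ⟩
    a + b + c ∸ c     ≡⟨ m+n∸n≡m (a + b) c ⟩
    a + b             ∎
    where open ≡-Reasoning

  ∣∁C─A∣≡b : ∣ C ∣ ≡ c → Disj A C → ∣ A ∣ ≡ a → ∣ ∁ C ─ A ∣ ≡ b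
  ∣∁C─A∣≡b {C} {A} ∣C∣≡c A#C ∣A∣≡a = +-cancelʳ-≡ a _ _ (begin
    ∣ ∁ C ─ A ∣ + a     ≡⟨ cong (∣ ∁ C ─ A ∣ +_) ∣A∣≡a ⟨
    ∣ ∁ C ─ A ∣ + ∣ A ∣ ≡⟨ ∣p─q∣+∣q∣≡∣p∣ (Disj⇒⊆∁ A#C) ⟩
    ∣ ∁ C ∣             ≡⟨ ∣∁C∣≡a+b {C} ∣C∣≡c ⟩
    a + b               ≡⟨ +-comm a b ⟩
    b + a               ∎)
    where open ≡-Reasoning

  IsDeal-of-hand : Disj A C → ∣ A ∣ ≡ a → ∣ C ∣ ≡ c →
                   IsDeal a b c A (∁ C ─ A) C
  IsDeal-of-hand A#C ∣A∣≡a ∣C∣≡c =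
    ( (λ x x∈A x∈∁C─A → x∈p─q⇒x∉q x∈∁C─A x∈A)
    , A#C
    , (λ x x∈∁C─A → x∈∁p⇒x∉p (p─q⊆p _ _ x∈∁C─A)) )
    , (∣A∣≡a , ∣∁C─A∣≡b ∣C∣≡c A#C ∣A∣≡a , ∣C∣≡c)

  IsDeal⇒B≡∁C─A : IsDeal a b c A B C → B ≡ ∁ C ─ A
  IsDeal⇒B≡∁C─A ((A#B , A#C , B#C) , (∣A∣≡a , ∣B∣≡b , ∣C∣≡c)) =
    ⊆∧∣q∣≤∣p∣⇒≡
      (λ {x} x∈B → x∈p∧x∉q⇒x∈p─q (x∉p⇒x∈∁p (B#C x x∈B)) (λ x∈A → A#B x x∈A x∈B))
      (≤-reflexive (trans (∣∁C─A∣≡b ∣C∣≡c A#C ∣A∣≡a) (sym ∣B∣≡b)))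

  IsDeal⇒sumOf : IsDeal a b c A B C → sumOf B + sumOf A ≡ sumOf (∁ C)
  IsDeal⇒sumOf {A = A} deal@((_ , A#C , _) , _) =
    trans (cong (λ B → sumOf B + sumOf A) (IsDeal⇒B≡∁C─A deal)) (weight-─ toℕ (Disj⇒⊆∁ A#C))

  ∣S∣≡a+b∸1⇒∣∁S∣≡1+c : {S : Subset n} → 1 ≤ a + b → ∣ S ∣ ≡ a + b ∸ 1 → ∣ ∁ S ∣ ≡ suc c
  ∣S∣≡a+b∸1⇒∣∁S∣≡1+c {S} 1≤a+b ∣S∣≡a+b∸1 = begin
    ∣ ∁ S ∣                  ≡⟨ ∣∁p∣≡n∸∣p∣ S ⟩
    n ∸ ∣ S ∣                ≡⟨ cong₂ _∸_ (sym a+b+c≡n) ∣S∣≡a+b∸1 ⟩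
    a + b + c ∸ (a + b ∸ 1)  ≡⟨ [m+c]∸[m∸1]≡1+c (a + b) 1≤a+b ⟩
    suc c                    ∎
    where
    open ≡-Reasoning
    [m+c]∸[m∸1]≡1+c : ∀ m → 1 ≤ m → m + c ∸ (m ∸ 1) ≡ suc c
    [m+c]∸[m∸1]≡1+c (suc m) _ = trans (cong (_∸ m) (sym (+-suc m c))) (m+n∸m≡n m (suc c))

  IsDeal⇒∈A : IsDeal a b c A B C → x ∉ C → x ∉ B → x ∈ A
  IsDeal⇒∈A {A = A} {x = x} deal x∉C x∉B with x ∈? A
  ... | yes x∈A = x∈A
  ... | no  x∉A = contradiction
    (subst (x ∈_) (sym (IsDeal⇒B≡∁C─A deal)) (x∈p∧x∉q⇒x∈p─q (x∉p⇒x∈∁p x∉C) x∉A)) x∉B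

crossing : {P : ℕ → Set} → Decidable P → ∀ s t → ¬ P s → P (t + s) → ∃[ u ] (¬ P u × P (suc u))
crossing P? s zero    ¬Ps Pt+s = contradiction Pt+s ¬Ps
crossing {P} P? s (suc t) ¬Ps Pt+s with P? (suc s)
... | yes P1+s = s , ¬Ps , P1+s
... | no ¬P1+s = crossing P? (suc s) t ¬P1+s (subst P (sym (+-suc t s)) Pt+s)

module _ {n : ℕ} .{{_ : NonZero n}} where

  +-cong-% : ∀ {m p q r} → m % n ≡ p % n → q % n ≡ r % n → (m + q) % n ≡ (p + r) % n
  +-cong-% {m} {p} {q} {r} m≡p q≡r = begin
    (m + q) % n             ≡⟨ %-distribˡ-+ m q n ⟩
    (m % n + q % n) % n     ≡⟨ cong₂ (λ x y → (x + y) % n) m≡p q≡r ⟩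
    (p % n + r % n) % n     ≡⟨ %-distribˡ-+ p r n ⟨
    (p + r) % n             ∎
    where open ≡-Reasoning

  [m+q+[n∸q%n]]%n≡m%n : ∀ m q → (m + q + (n ∸ q % n)) % n ≡ m % n
  [m+q+[n∸q%n]]%n≡m%n m q = begin
    (m + q + (n ∸ q % n)) % n               ≡⟨ cong (_% n) (+-assoc m q _) ⟩
    (m + (q + (n ∸ q % n))) % n             ≡⟨ cong (λ x → (m + (x + (n ∸ q % n))) % n) (m≡m%n+[m/n]*n q n) ⟩
    (m + (q % n + q / n * n + (n ∸ q % n))) % n ≡⟨ cong (λ x → (m + x) % n) (CS.xy∙z≈y∙xz +-commutativeSemigroup (q % n) _ _) ⟩
    (m + (q / n * n + (q % n + (n ∸ q % n)))) % n ≡⟨ cong (λ x → (m + (q / n * n + x)) % n) (m+[n∸m]≡n (m%n≤n q n)) ⟩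
    (m + (q / n * n + n)) % n               ≡⟨ cong (λ x → (m + x) % n) (+-comm (q / n * n) n) ⟩
    (m + suc (q / n) * n) % n               ≡⟨ [m+kn]%n≡m%n m (suc (q / n)) n ⟩
    m % n                                   ∎
    where open ≡-Reasoning

  %-cancelʳ-+ : ∀ m p q → (m + q) % n ≡ (p + q) % n → m % n ≡ p % n
  %-cancelʳ-+ m p q m+q≡p+q = begin
    m % n                   ≡⟨ [m+q+[n∸q%n]]%n≡m%n m q ⟨
    (m + q + (n ∸ q % n)) % n ≡⟨ +-cong-% m+q≡p+q refl ⟩
    (p + q + (n ∸ q % n)) % n ≡⟨ [m+q+[n∸q%n]]%n≡m%n p q ⟩
    p % n                   ∎
    where open ≡-Reasoning

  %-cancel-+ : ∀ {m p q r} → m + q ≡ p + r → q % n ≡ r % n → m % n ≡ p % n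
  %-cancel-+ {m} {p} {q} {r} m+q≡p+r q≡r =
    %-cancelʳ-+ m p q (trans (cong (_% n) m+q≡p+r) (+-cong-% {p} {p} refl (sym q≡r)))

  [s+[n∸s%n+y]]%n≡y%n : ∀ s y → (s + (n ∸ s % n + y)) % n ≡ y % n
  [s+[n∸s%n+y]]%n≡y%n s y =
    trans (cong (_% n) (CS.x∙yz≈zx∙y +-commutativeSemigroup s _ y)) ([m+q+[n∸q%n]]%n≡m%n y s)

  %-cancel-succ : ∀ m p u → (m + u % n) % n ≡ (p + suc u % n) % n → m % n ≡ suc p % n
  %-cancel-succ m p u m+u≡p+1+u = %-cancelʳ-+ m (suc p) u (begin
    (m + u) % n             ≡⟨ +-cong-% {m} refl (sym (m%n%n≡m%n u n)) ⟩
    (m + u % n) % n         ≡⟨ m+u≡p+1+u ⟩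
    (p + suc u % n) % n     ≡⟨ +-cong-% {p} refl (m%n%n≡m%n (suc u) n) ⟩
    (p + suc u) % n         ≡⟨ cong (_% n) (+-suc p u) ⟩
    (suc p + u) % n         ∎)
    where open ≡-Reasoning

  mod≡ : ∀ {m} {i : Fin n} → m % n ≡ toℕ i → m mod n ≡ i
  mod≡ {m} m%n≡i = toℕ-injective (trans (toℕ-fromℕ< (m%n<n m n)) m%n≡i)

  cyclic-crossing : {C : Subset n} {v w : Fin n} → v ∉ C → w ∈ C →
                    ∃[ u ] (u mod n ∉ C × suc u mod n ∈ C)
  cyclic-crossing {C} {v} {w} v∉C w∈C =
    crossing (λ m → m mod n ∈? C) (toℕ v) (toℕ w + (n ∸ toℕ v))
      (subst (_∉ C) (sym (mod≡ (m<n⇒m%n≡m (toℕ<n v)))) v∉C)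
      (subst (_∈ C) (sym (mod≡ (begin
        (toℕ w + (n ∸ toℕ v) + toℕ v) % n ≡⟨ cong (_% n) (+-assoc (toℕ w) _ _) ⟩
        (toℕ w + (n ∸ toℕ v + toℕ v)) % n ≡⟨ cong (λ x → (toℕ w + x) % n) (m∸n+n≡m (<⇒≤ (toℕ<n v))) ⟩
        (toℕ w + n) % n                   ≡⟨ [m+n]%n≡m%n (toℕ w) n ⟩
        toℕ w % n                         ≡⟨ m<n⇒m%n≡m (toℕ<n w) ⟩
        toℕ w                             ∎))) w∈C)
    where open ≡-Reasoning

sum-zipWith-tabulate : ∀ {m d} (X : Subset m) (h : Fin m → Fin d) →
  sum (zipWith (λ s i → if s then toℕ i else 0) X (tabulate h)) ≡ weight (toℕ ∘ h) X
sum-zipWith-tabulate []            h = refl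
sum-zipWith-tabulate (inside ∷ X)  h = cong (toℕ (h zero) +_) (sum-zipWith-tabulate X (h ∘ suc))
sum-zipWith-tabulate (outside ∷ X) h = sum-zipWith-tabulate X (h ∘ suc)

sumD≡sumOf% : ∀ {k} (X : Subset (suc k)) → sumD X ≡ sumOf X % suc k
sumD≡sumOf% {k} X = cong (_% suc k) (sum-zipWith-tabulate X (λ i → i))

SumCondition : ℕ → ℕ → ℕ → Set
SumCondition a b d = ∀ (x : Fin d) (S : Subset d) → ∣ S ∣ ≡ a + b ∸ 1 →
  ∃[ A ] ∃[ B ] (A ⊆ S × B ⊆ S × ∣ A ∣ ≡ a × ∣ B ∣ ≡ b × sumD A ≡ toℕ x × sumD B ≡ toℕ x)

module _ {k : ℕ} where
  private
    d : ℕ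
    d = suc k

  sumD≡⇒%≡ : {X Y : Subset d} → sumD X ≡ sumD Y → sumOf X % d ≡ sumOf Y % d
  sumD≡⇒%≡ {X} {Y} ΣX≡ΣY = trans (sym (sumD≡sumOf% X)) (trans ΣX≡ΣY (sumD≡sumOf% Y))

  toℕ-mod≡sumD : (X : Subset d) → toℕ (sumOf X mod d) ≡ sumD X
  toℕ-mod≡sumD X = trans (toℕ-fromℕ< (m%n<n (sumOf X) d)) (sym (sumD≡sumOf% X))

  module _ {a b c : ℕ} (a+b+c≡d : a + b + c ≡ d) where

    sumD-other : {A B A' B' C : Subset d} → IsDeal a b c A B C → IsDeal a b c A' B' C →
                 sumD A' ≡ sumD A → sumD B' ≡ sumD B
    sumD-other {A} {B} {A'} {B'} deal deal' ΣA'≡ΣA = begin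
      sumD B'         ≡⟨ sumD≡sumOf% B' ⟩
      sumOf B' % d    ≡⟨ %-cancel-+ {d} {sumOf B'} {sumOf B}
                           (trans (IsDeal⇒sumOf a+b+c≡d deal') (sym (IsDeal⇒sumOf a+b+c≡d deal)))
                           (sumD≡⇒%≡ {A'} {A} ΣA'≡ΣA) ⟩
      sumOf B % d     ≡⟨ sumD≡sumOf% B ⟨
      sumD B          ∎
      where open ≡-Reasoning

    SecureSum-swap : SecureSum a b c d → SecureSum b a c d
    SecureSum-swap secure B A C deal z z∉C with secure A B C (IsDeal-swap deal) z z∉C
    ... | (A₁ , B₁ , deal₁ , ΣA₁ , z∉A₁) , (A₂ , B₂ , deal₂ , ΣA₂ , z∉B₂) =
        (B₂ , A₂ , IsDeal-swap deal₂ , sumD-other (IsDeal-swap deal) deal₂ ΣA₂ , z∉B₂)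
      , (B₁ , A₁ , IsDeal-swap deal₁ , sumD-other (IsDeal-swap deal) deal₁ ΣA₁ , z∉A₁)

    module _ (secure : SecureSum a b c d) where

      -- Security lets Alice lack z, so her hand also avoids C'; Bob takes the rest.
      transport : {A B C C' : Subset d} {z : Fin d} → IsDeal a b c A B C → z ∉ C →
                  C' ⊆ C ∪ ⁅ z ⁆ → ∣ C' ∣ ≡ c →
                  ∃[ A' ] ∃[ B' ] (IsDeal a b c A' B' C' × sumD A' ≡ sumD A)
      transport {C = C} {C'} {z} deal z∉C C'⊆C∪⁅z⁆ ∣C'∣≡c
        with proj₁ (secure _ _ C deal z z∉C)
      ... | A₁ , _ , ((_ , A₁#C , _) , (∣A₁∣≡a , _)) , ΣA₁ , z∉A₁ =
        A₁ , ∁ C' ─ A₁ , IsDeal-of-hand a+b+c≡d A₁#C' ∣A₁∣≡a ∣C'∣≡c , ΣA₁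
        where
        A₁#C' : Disj A₁ C'
        A₁#C' x x∈A₁ x∈C' with x∈p∪q⁻ C ⁅ z ⁆ (C'⊆C∪⁅z⁆ x∈C')
        ... | inj₁ x∈C   = A₁#C x x∈A₁ x∈C
        ... | inj₂ x∈⁅z⁆ = z∉A₁ (subst (_∈ A₁) (x∈⁅y⁆⇒x≡y z x∈⁅z⁆) x∈A₁)

      -- Security lets Bob lack z, so Alice holds it; she trades it for Cath's w.
      shift : {A B C : Subset d} {z w : Fin d} → IsDeal a b c A B C → z ∉ C → w ∈ C →
              ∃[ A' ] ∃[ B' ] (IsDeal a b c A' B' (replace w z C)
                               × (sumOf A' + toℕ z) % d ≡ (sumOf A + toℕ w) % d)
      shift {A} {C = C} {z} {w} deal z∉C w∈C with proj₂ (secure _ _ C deal z z∉C)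
      ... | A₁ , _ , deal₁@((_ , A₁#C , _) , (∣A₁∣≡a , _ , ∣C∣≡c)) , ΣA₁ , z∉B₁ =
        A₂ , ∁ C' ─ A₂ , IsDeal-of-hand a+b+c≡d A₂#C' ∣A₂∣≡a ∣C'∣≡c , Σ-shift
        where
        C' A₂ : Subset d
        C' = replace w z C
        A₂ = replace z w A₁
        z∈A₁ : z ∈ A₁
        z∈A₁ = IsDeal⇒∈A a+b+c≡d deal₁ z∉C z∉B₁
        w∉A₁ : w ∉ A₁
        w∉A₁ w∈A₁ = A₁#C w w∈A₁ w∈C
        ∣A₂∣≡a : ∣ A₂ ∣ ≡ a
        ∣A₂∣≡a = trans (∣replace∣≡∣p∣ z∈A₁ w∉A₁) ∣A₁∣≡a
        ∣C'∣≡c : ∣ C' ∣ ≡ c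
        ∣C'∣≡c = trans (∣replace∣≡∣p∣ w∈C z∉C) ∣C∣≡c
        A₂#C' : Disj A₂ C'
        A₂#C' x x∈A₂ x∈C' with ∈-replace⁻ x∈A₂ | ∈-replace⁻ x∈C'
        ... | inj₁ refl         | inj₁ refl         = z∉C w∈C
        ... | inj₁ refl         | inj₂ (_ , x≢w)    = x≢w refl
        ... | inj₂ (_ , x≢z)    | inj₁ refl         = x≢z refl
        ... | inj₂ (x∈A₁ , _)   | inj₂ (x∈C , _)    = A₁#C x x∈A₁ x∈C
        Σ-shift : (sumOf A₂ + toℕ z) % d ≡ (sumOf A + toℕ w) % d
        Σ-shift = trans (cong (_% d) (weight-replace toℕ z∈A₁ w∉A₁))
                        (+-cong-% {d} {sumOf A₁} {sumOf A} (sumD≡⇒%≡ {A₁} {A} ΣA₁) refl)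

      -- Shift along a cyclically adjacent pair z ∉ C, z + 1 ∈ C, then transport back to C.
      increment : {A B C : Subset d} → 1 ≤ c → 1 ≤ a + b → IsDeal a b c A B C →
                  ∃[ A' ] ∃[ B' ] (IsDeal a b c A' B' C × sumOf A' % d ≡ suc (sumOf A) % d)
      increment {A} {C = C} 1≤c 1≤a+b deal@(_ , (_ , _ , ∣C∣≡c))
        with 0<∣p∣⇒Nonempty (subst (0 <_) (sym ∣C∣≡c) 1≤c)
           | 0<∣p∣⇒Nonempty (subst (0 <_) (sym (∣∁C∣≡a+b {a = a} {b} {c} a+b+c≡d {C} ∣C∣≡c)) 1≤a+b)
      ... | w , w∈C | v , v∈∁C with cyclic-crossing (x∈∁p⇒x∉p v∈∁C) w∈C
      ... | u , u∉C , 1+u∈C with shift deal u∉C 1+u∈C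
      ... | A₂ , _ , deal₂ , Σ-shift
        with transport deal₂ (i∉replace 1+u∈C u∉C) p⊆replace∪⁅i⁆ ∣C∣≡c
      ... | A₃ , B₃ , deal₃ , ΣA₃ =
        A₃ , B₃ , deal₃ ,
        trans (sumD≡⇒%≡ {A₃} {A₂} ΣA₃)
              (%-cancel-succ (sumOf A₂) (sumOf A) u
                 (subst₂ (λ s t → (sumOf A₂ + s) % d ≡ (sumOf A + t) % d)
                         (toℕ-fromℕ< (m%n<n u d)) (toℕ-fromℕ< (m%n<n (suc u) d)) Σ-shift))

      increments : {A B C : Subset d} → 1 ≤ c → 1 ≤ a + b → IsDeal a b c A B C → ∀ j →
                   ∃[ A' ] ∃[ B' ] (IsDeal a b c A' B' C × sumOf A' % d ≡ (sumOf A + j) % d)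
      increments {A} {B} 1≤c 1≤a+b deal zero = A , B , deal , cong (_% d) (sym (+-identityʳ (sumOf A)))
      increments {A} 1≤c 1≤a+b deal (suc j) =
        let A' , _ , deal' , ΣA' = increments 1≤c 1≤a+b deal j
            A'' , B'' , deal'' , ΣA'' = increment 1≤c 1≤a+b deal'
        in  A'' , B'' , deal'' ,
            trans ΣA'' (trans (+-cong-% {d} {1} {1} refl ΣA') (cong (_% d) (sym (+-suc (sumOf A) j))))

      every-sum : {C : Subset d} → 1 ≤ c → 1 ≤ a + b → ∣ C ∣ ≡ c → ∀ y →
                  ∃[ A ] ∃[ B ] (IsDeal a b c A B C × sumOf A % d ≡ y % d)
      every-sum {C} 1≤c 1≤a+b ∣C∣≡c y
        with ∃⊆-of-size {p = ∁ C}
               (subst (a ≤_) (sym (∣∁C∣≡a+b {a = a} {b} {c} a+b+c≡d {C} ∣C∣≡c)) (m≤m+n a b))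
      ... | A₀ , A₀⊆∁C , ∣A₀∣≡a
        with increments 1≤c 1≤a+b (IsDeal-of-hand a+b+c≡d (⊆∁⇒Disj A₀⊆∁C) ∣A₀∣≡a ∣C∣≡c)
                        (d ∸ sumOf A₀ % d + y)
      ... | A , B , deal , ΣA = A , B , deal , trans ΣA ([s+[n∸s%n+y]]%n≡y%n (sumOf A₀) y)

      hand-avoiding : {C : Subset d} {w : Fin d} → 1 ≤ c → 1 ≤ a + b → ∣ C ∣ ≡ c → w ∉ C →
                      ∀ (x : Fin d) → ∃[ A ] (Disj A C × w ∉ A × ∣ A ∣ ≡ a × sumD A ≡ toℕ x)
      hand-avoiding {C} {w} 1≤c 1≤a+b ∣C∣≡c w∉C x with every-sum 1≤c 1≤a+b ∣C∣≡c (toℕ x)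
      ... | A₀ , B₀ , deal₀ , ΣA₀ with proj₁ (secure A₀ B₀ C deal₀ w w∉C)
      ... | A , _ , ((_ , A#C , _) , (∣A∣≡a , _)) , ΣA≡ΣA₀ , w∉A = A , A#C , w∉A , ∣A∣≡a , (begin
        sumD A          ≡⟨ ΣA≡ΣA₀ ⟩
        sumD A₀         ≡⟨ sumD≡sumOf% A₀ ⟩
        sumOf A₀ % d    ≡⟨ ΣA₀ ⟩
        toℕ x % d       ≡⟨ m<n⇒m%n≡m (toℕ<n x) ⟩
        toℕ x           ∎)
        where open ≡-Reasoning

      secure⇒hand : 1 ≤ c → 1 ≤ a + b → ∀ (x : Fin d) (S : Subset d) → ∣ S ∣ ≡ a + b ∸ 1 →
                    ∃[ A ] (A ⊆ S × ∣ A ∣ ≡ a × sumD A ≡ toℕ x)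
      secure⇒hand 1≤c 1≤a+b x S ∣S∣≡a+b∸1 =
        let w , w∈∁S = 0<∣p∣⇒Nonempty (subst (0 <_) (sym ∣∁S∣≡1+c) (s≤s z≤n))
            A , A#∁S-w , w∉A , ∣A∣≡a , ΣA = hand-avoiding 1≤c 1≤a+b (∣∁S-w∣≡c w∈∁S) x∉p-x x
        in  A , Disj-∁-x⇒⊆ A#∁S-w w∉A , ∣A∣≡a , ΣA
        where
        ∣∁S∣≡1+c : ∣ ∁ S ∣ ≡ suc c
        ∣∁S∣≡1+c = ∣S∣≡a+b∸1⇒∣∁S∣≡1+c {a = a} {b} {c} a+b+c≡d {S} 1≤a+b ∣S∣≡a+b∸1
        ∣∁S-w∣≡c : ∀ {w} → w ∈ ∁ S → ∣ ∁ S - w ∣ ≡ c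
        ∣∁S-w∣≡c {w} w∈∁S = suc-injective (trans (+-comm 1 ∣ ∁ S - w ∣) (trans (∣p-x∣+1≡∣p∣ w∈∁S) ∣∁S∣≡1+c))

  condition⇒secure : {a b c : ℕ} → a + b + c ≡ d → SumCondition a b d → SecureSum a b c d
  condition⇒secure {a} {b} {c} a+b+c≡d condition A B C deal@(_ , (_ , _ , ∣C∣≡c)) z z∉C =
    part₁ , part₂
    where
    S : Subset d
    S = ∁ C - z
    ∣S∣≡a+b∸1 : ∣ S ∣ ≡ a + b ∸ 1
    ∣S∣≡a+b∸1 = trans (sym (m+n∸n≡m ∣ S ∣ 1))
      (cong (_∸ 1) (trans (∣p-x∣+1≡∣p∣ (x∉p⇒x∈∁p z∉C)) (∣∁C∣≡a+b {a = a} {b} {c} a+b+c≡d {C} ∣C∣≡c)))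
    ⊆S⇒Disj : ∀ {X} → X ⊆ S → Disj X C
    ⊆S⇒Disj X⊆S = ⊆∁⇒Disj (λ x∈X → p─q⊆p (∁ C) ⁅ z ⁆ (X⊆S x∈X))
    ⊆S⇒z∉ : ∀ {X} → X ⊆ S → z ∉ X
    ⊆S⇒z∉ X⊆S z∈X = x∈p─q⇒x∉q (X⊆S z∈X) (x∈⁅x⁆ z)
    part₁ : ∃[ A' ] ∃[ B' ] (IsDeal a b c A' B' C × sumD A' ≡ sumD A × z ∉ A')
    part₁ =
      let A₁ , _ , A₁⊆S , _ , ∣A₁∣≡a , _ , ΣA₁ , _ = condition (sumOf A mod d) S ∣S∣≡a+b∸1
      in  A₁ , ∁ C ─ A₁ , IsDeal-of-hand a+b+c≡d (⊆S⇒Disj A₁⊆S) ∣A₁∣≡a ∣C∣≡c ,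
          trans ΣA₁ (toℕ-mod≡sumD A) , ⊆S⇒z∉ A₁⊆S
    part₂ : ∃[ A' ] ∃[ B' ] (IsDeal a b c A' B' C × sumD A' ≡ sumD A × z ∉ B')
    part₂ =
      let _ , B₁ , _ , B₁⊆S , _ , ∣B₁∣≡b , _ , ΣB₁ = condition (sumOf B mod d) S ∣S∣≡a+b∸1
          deal₁ = IsDeal-of-hand (b+a+c≡n a b a+b+c≡d) (⊆S⇒Disj B₁⊆S) ∣B₁∣≡b ∣C∣≡c
      in  ∁ C ─ B₁ , B₁ , IsDeal-swap deal₁ ,
          sumD-other (b+a+c≡n a b a+b+c≡d) (IsDeal-swap deal) deal₁ (trans ΣB₁ (toℕ-mod≡sumD B)) , ⊆S⇒z∉ B₁⊆S

  secure⇒condition : {a b c : ℕ} → a + b + c ≡ d → 1 ≤ a → 1 ≤ b → 1 ≤ c →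
                     SecureSum a b c d → SumCondition a b d
  secure⇒condition {a} {b} {c} a+b+c≡d 1≤a 1≤b 1≤c secure x S ∣S∣≡a+b∸1 =
    let A , A⊆S , ∣A∣≡a , ΣA = secure⇒hand a+b+c≡d secure 1≤c (≤-trans 1≤a (m≤m+n a b)) x S ∣S∣≡a+b∸1
        B , B⊆S , ∣B∣≡b , ΣB = secure⇒hand (b+a+c≡n a b a+b+c≡d) (SecureSum-swap a+b+c≡d secure) 1≤c
                                 (≤-trans 1≤b (m≤m+n b a)) x S (trans ∣S∣≡a+b∸1 (cong (_∸ 1) (+-comm a b)))
    in  A , B , A⊆S , B⊆S , ∣A∣≡a , ∣B∣≡b , ΣA , ΣB

mainTheorem4 : (a b c : ℕ) → 1 ≤ a → 1 ≤ b → 1 ≤ c →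
    SecureSum a b c (a + b + c)
    ⇔ (∀ (x : Fin (a + b + c)) (S : Subset (a + b + c)) → ∣ S ∣ ≡ a + b ∸ 1 →
        ∃[ A ] ∃[ B ] (A ⊆ S × B ⊆ S × ∣ A ∣ ≡ a × ∣ B ∣ ≡ b
          × sumD A ≡ toℕ x × sumD B ≡ toℕ x))
mainTheorem4 (suc a) b c 1≤a 1≤b 1≤c =
  mk⇔ (secure⇒condition refl 1≤a 1≤b 1≤c) (condition⇒secure refl)
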